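{- Let $n\geqslant 7$ and $s\leqslant \lfloor n/4\rfloor$. Let $F$ be a graph on $n-1$ vertices such that $P_{n-1}^2$ packs with $F$. Then $P_n^2$ packs with every graph in $F^{+s}$.
   Context: All graphs are finite and simple. $P_m$ is the path on $m$ vertices and $P_m^2$ its square: same vertex set, two vertices adjacent iff their distance in $P_m$ is at most two. Two graphs $G,H$ on $m$ vertices pack if $K_m$ contains edge-disjoint copies of $G$ and $H$. For a graph $F$, $F^{+s}$ denotes the set of graphs obtained from $F$ by adding one new vertex and joining it to some $s$ vertices of $F$. -}

module Defs where

open import Data.Nat using (ℕ; suc; _≤_; _<_; _+_)
open import Data.Nat.Properties using (<-irrefl)
open import Data.Fin using (Fin; zero; suc; toℕ)
open import Data.Fin.Subset using (Subset; _∈_)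
open import Data.Empty using (⊥)
open import Data.Sum using (_⊎_; inj₁; inj₂)
open import Data.Product using (Σ; _×_; _,_; proj₁)
open import Data.Fin.Permutation using (Permutation′; _⟨$⟩ʳ_)
open import Relation.Nullary using (¬_)
open import Relation.Binary.PropositionalEquality using (refl)

record Graph (m : ℕ) : Set₁ where
  field
    Adj    : Fin m → Fin m → Set
    irrefl : ∀ u → ¬ Adj u u
    sym    : ∀ u v → Adj u v → Adj v u
open Graph public

-- Two graphs on m vertices pack iff K_m contains edge-disjoint copies of
-- them; equivalently (placing G identically) there is a permutation σ of
-- the vertex set such that no edge uv of G is mapped onto an edge of H.
Packs : ∀ {m} → Graph m → Graph m → Set
Packs {m} G H = Σ (Permutation′ m) λ σ →
  ∀ u v → Adj G u v → ¬ Adj H (σ ⟨$⟩ʳ u) (σ ⟨$⟩ʳ v)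

PathSqAdj : ∀ {m} → Fin m → Fin m → Set
PathSqAdj i j = (toℕ i < toℕ j × toℕ j ≤ toℕ i + 2)
              ⊎ (toℕ j < toℕ i × toℕ i ≤ toℕ j + 2)

PathSq : (m : ℕ) → Graph m
PathSq m = record { Adj = PathSqAdj ; irrefl = irr ; sym = sy }
  where
  irr : ∀ u → ¬ PathSqAdj u u
  irr u (inj₁ (p , _)) = <-irrefl refl p
  irr u (inj₂ (p , _)) = <-irrefl refl p
  sy : ∀ u v → PathSqAdj u v → PathSqAdj v u
  sy u v (inj₁ p) = inj₂ p
  sy u v (inj₂ p) = inj₁ p

-- Adding a new vertex (here: zero; old vertex v becomes suc v) joined
-- exactly to the vertices of S.
ExtAdj : ∀ {m} → Graph m → Subset m → Fin (suc m) → Fin (suc m) → Set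
ExtAdj F S zero    zero    = ⊥
ExtAdj F S zero    (suc v) = v ∈ S
ExtAdj F S (suc u) zero    = u ∈ S
ExtAdj F S (suc u) (suc v) = Adj F u v

extend : ∀ {m} → Graph m → Subset m → Graph (suc m)
extend F S = record { Adj = ExtAdj F S ; irrefl = irr ; sym = sy }
  where
  irr : ∀ u → ¬ ExtAdj F S u u
  irr zero ()
  irr (suc u) = irrefl F u
  sy : ∀ u v → ExtAdj F S u v → ExtAdj F S v u
  sy zero zero ()
  sy zero (suc v) p = p
  sy (suc u) zero p = p
  sy (suc u) (suc v) p = sym F u v p

module Submission where

-- Insert the new vertex of F at a position k of the path P_{n-1}, keeping the
-- packing of P_{n-1}² with F on the old vertices. This works as soon as none of the
-- at most four path vertices k-2, …, k+1 is mapped into S. Cut the path into its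
-- first two vertices, blocks of four, and its last two vertices: if 4s ≤ n - 1 there
-- are s + 1 pieces, so one of them misses the s vertices mapped into S, giving k.
-- If 4s = n the pieces do not fit; a closer look at the first five vertices finds a
-- slot again, except in one configuration, which is handled by first exchanging the
-- path vertices 0 and 1.

open import Defs
open import Data.Nat using (ℕ; zero; suc; _+_; _*_; _≤_; _<_; _/_; z≤n; s≤s; _≟_)
open import Data.Nat.Properties
open import Data.Nat.DivMod using (m/n*n≤m)
open import Data.Bool using (Bool; true; false)
open import Data.Empty using (⊥-elim)
open import Data.Fin using (Fin; zero; suc; toℕ; fromℕ<; punchIn; punchOut) renaming (_≟_ to _≟ᶠ_)
open import Data.Fin.Properties using (toℕ-fromℕ<; punchIn-punchOut)
open import Data.Fin.Permutation using (Permutation′; _⟨$⟩ʳ_; _∘ₚ_; insert; insert-punchIn; transpose)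
  renaming (id to idₚ)
open import Data.Fin.Subset using (Subset; _∈_; ∣_∣)
open import Data.Vec using ([]; _∷_; lookup)
open import Data.Vec.Properties using ([]=⇒lookup)
open import Data.Product using (∃; _×_; _,_; proj₁; proj₂; uncurry)
open import Data.Sum using (_⊎_; inj₁; inj₂; [_,_]′; swap)
open import Function using (_∘_)
open import Relation.Nullary using (¬_; yes; no)
open import Relation.Binary.PropositionalEquality
  using (_≡_; refl; cong; subst; trans; module ≡-Reasoning) renaming (sym to ≡-sym)
open import Algebra.Properties.CommutativeMonoid.Sum +-0-commutativeMonoid using (sum; sum-permute)

module Windows (B : ℕ → ℕ) where

  count : ℕ → ℕ → ℕ
  count a zero    = 0
  count a (suc l) = B a + count (suc a) l

  count-+ : ∀ a l l′ → count a (l + l′) ≡ count a l + count (a + l) l′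
  count-+ a zero    l′ = cong (λ x → count x l′) (≡-sym (+-identityʳ a))
  count-+ a (suc l) l′ = begin
    B a + count (suc a) (l + l′)                      ≡⟨ cong (B a +_) (count-+ (suc a) l l′) ⟩
    B a + (count (suc a) l + count (suc (a + l)) l′)  ≡⟨ ≡-sym (+-assoc (B a) _ _) ⟩
    count a (suc l) + count (suc (a + l)) l′          ≡⟨ cong (λ x → count a (suc l) + count x l′) (≡-sym (+-suc a l)) ⟩
    count a (suc l) + count (a + suc l) l′            ∎
    where open ≡-Reasoning

  count-mono-≤ : ∀ a {l l′} → l ≤ l′ → count a l ≤ count a l′
  count-mono-≤ a {l} l≤l′ with m≤n⇒∃[o]m+o≡n l≤l′
  ... | o , refl = subst (count a l ≤_) (≡-sym (count-+ a l o)) (m≤m+n _ _)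

  Vanishes : ℕ → ℕ → Set
  Vanishes a l = ∀ i → i < l → B (a + i) ≡ 0

  vanishes-or-count>0 : ∀ a l → Vanishes a l ⊎ 0 < count a l
  vanishes-or-count>0 a zero = inj₁ λ _ ()
  vanishes-or-count>0 a (suc l) with B a ≟ 0 | vanishes-or-count>0 (suc a) l
  ... | no Ba≢0 | _        = inj₂ (<-≤-trans (n≢0⇒n>0 Ba≢0) (m≤m+n _ _))
  ... | yes _   | inj₂ pos = inj₂ (<-≤-trans pos (m≤n+m _ _))
  ... | yes Ba≡0 | inj₁ rest = inj₁ vanish
    where
    vanish : Vanishes a (suc l)
    vanish zero    _         = trans (cong B (+-identityʳ a)) Ba≡0
    vanish (suc i) (s≤s i<l) = trans (cong B (+-suc a i)) (rest i i<l)

  vanishing-block-or-count≥ : ∀ a l k →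
    (∃ λ j → j + l ≤ a + k * l × Vanishes j l) ⊎ k ≤ count a (k * l)
  vanishing-block-or-count≥ a l zero = inj₂ z≤n
  vanishing-block-or-count≥ a l (suc k)
    with vanishes-or-count>0 a l | vanishing-block-or-count≥ (a + l) l k
  ... | inj₁ z   | _ = inj₁ (a , +-monoʳ-≤ a (m≤m+n l _) , z)
  ... | inj₂ _   | inj₁ (j , end , z) = inj₁ (j , subst (j + l ≤_) (+-assoc a l (k * l)) end , z)
  ... | inj₂ pos | inj₂ c = inj₂ (subst (suc k ≤_) (≡-sym (count-+ a l (k * l))) (+-mono-≤ pos c))

  -- A new vertex inserted at position k of the path P_m is adjacent to the old
  -- vertices k-2, k-1, k, k+1 (those that exist).
  FreeSlot : ℕ → Set
  FreeSlot m = ∃ λ k → k ≤ m × (∀ j → k ≤ j + 2 → j < k + 2 → B j ≡ 0)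

  -- Listing the path as 1, 0, 2, 3, … and inserting the new vertex at position 3
  -- makes it adjacent to the old vertices 0, 2, 3 and 4.
  FreeSwappedSlot : Set
  FreeSwappedSlot = B 0 ≡ 0 × B 2 ≡ 0 × B 3 ≡ 0 × B 4 ≡ 0

  VanishesFrom : ℕ → Set
  VanishesFrom m = ∀ j → m ≤ j → B j ≡ 0

  free-slot-at-start : ∀ {m} → Vanishes 0 2 → FreeSlot m
  free-slot-at-start z = 0 , z≤n , λ j _ j<2 → z j j<2

  free-slot-inside : ∀ {m} j → Vanishes j 4 → j + 2 ≤ m → FreeSlot m
  free-slot-inside j z j+2≤m = j + 2 , j+2≤m , vanish
    where
    vanish : ∀ i → j + 2 ≤ i + 2 → i < j + 2 + 2 → B i ≡ 0
    vanish i lo hi with m≤n⇒∃[o]m+o≡n (+-cancelʳ-≤ 2 j i lo)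
    ... | o , refl = z o (+-cancelˡ-< j _ _ (subst (j + o <_) (+-assoc j 2 2) hi))

  free-slot-at-end : ∀ {m} p → Vanishes p 2 → p + 2 ≡ m → VanishesFrom m → FreeSlot m
  free-slot-at-end p z refl tail = free-slot-inside p vanish ≤-refl
    where
    vanish : Vanishes p 4
    vanish 0 _ = z 0 (s≤s z≤n)
    vanish 1 _ = z 1 (s≤s (s≤s z≤n))
    vanish 2 _ = tail (p + 2) ≤-refl
    vanish 3 _ = tail (p + 3) (+-monoʳ-≤ p (n≤1+n 2))
    vanish (suc (suc (suc (suc _)))) (s≤s (s≤s (s≤s (s≤s ()))))

  -- Pigeonhole: the prefix, k blocks of length 4 and the final pair carry weight
  -- at least c + k + 1 unless a block or the final pair vanishes.
  free-slot-after-prefix : ∀ p k r c {m} → p + k * 4 + r + 2 ≡ m →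
    c ≤ count 0 p → count 0 m ≤ c + k → VanishesFrom m → FreeSlot m
  free-slot-after-prefix p k r c refl prefix total tail
    with vanishing-block-or-count≥ p 4 k | vanishes-or-count>0 (p + k * 4 + r) 2
  ... | inj₁ (j , j+4≤ , z) | _ =
    free-slot-inside j z (≤-trans (+-monoʳ-≤ j (m≤m+n 2 2))
                           (≤-trans j+4≤ (≤-trans (m≤m+n _ r) (m≤m+n _ 2))))
  ... | inj₂ _      | inj₁ z   = free-slot-at-end _ z refl tail
  ... | inj₂ blocks | inj₂ end = ⊥-elim (<⇒≱ too-heavy total)
    where
    open ≤-Reasoning
    too-heavy : c + k < count 0 (p + k * 4 + r + 2)
    too-heavy = begin-strict
      c + k                                           ≤⟨ +-mono-≤ prefix blocks ⟩
      count 0 p + count p (k * 4)                     ≡⟨ ≡-sym (count-+ 0 p (k * 4)) ⟩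
      count 0 (p + k * 4)                             ≤⟨ count-mono-≤ 0 (m≤m+n (p + k * 4) r) ⟩
      count 0 (p + k * 4 + r)                         <⟨ m<m+n _ end ⟩
      count 0 (p + k * 4 + r) + count (p + k * 4 + r) 2 ≡⟨ ≡-sym (count-+ 0 (p + k * 4 + r) 2) ⟩
      count 0 (p + k * 4 + r + 2)                     ∎

  five-prefix : Vanishes 0 2 ⊎ Vanishes 1 4 ⊎ FreeSwappedSlot ⊎ 2 ≤ count 0 5
  five-prefix with vanishes-or-count>0 0 2 | vanishes-or-count>0 1 4
  ... | inj₁ z | _      = inj₁ z
  ... | _      | inj₁ z = inj₂ (inj₁ z)
  ... | inj₂ pos₀₁ | inj₂ pos₁₋₄ with B 0 ≟ 0
  ...   | no B0≢0 = inj₂ (inj₂ (inj₂ (+-mono-≤ (n≢0⇒n>0 B0≢0) pos₁₋₄)))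
  ...   | yes B0≡0 with vanishes-or-count>0 2 3
  ...     | inj₁ z = inj₂ (inj₂ (inj₁ (B0≡0 , z 0 (s≤s z≤n) , z 1 (s≤s (s≤s z≤n)) , z 2 ≤-refl)))
  ...     | inj₂ pos₂₋₄ = inj₂ (inj₂ (inj₂ (≤-trans (+-mono-≤ pos₁ pos₂₋₄) (m≤n+m _ (B 0)))))
    where
    pos₁ : 0 < B 1
    pos₁ = subst (0 <_) (+-identityʳ (B 1)) (subst (λ x → 0 < x + (B 1 + 0)) B0≡0 pos₀₁)

  free-slot-if-4s≤m : ∀ m s → 2 ≤ m → s * 4 ≤ m → count 0 m ≤ s → VanishesFrom m → FreeSlot m
  free-slot-if-4s≤m m s 2≤m s*4≤m total tail with vanishes-or-count>0 0 2
  free-slot-if-4s≤m m s       2≤m s*4≤m total tail | inj₁ z = free-slot-at-start z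
  free-slot-if-4s≤m m zero    2≤m s*4≤m total tail | inj₂ pos =
    ⊥-elim (<⇒≱ pos (≤-trans (count-mono-≤ 0 2≤m) total))
  free-slot-if-4s≤m m (suc t) 2≤m s*4≤m total tail | inj₂ pos with m≤n⇒∃[o]m+o≡n s*4≤m
  ... | o , 4+4t+o≡m = free-slot-after-prefix 2 t o 1 shape pos total tail
    where
    shape : 2 + t * 4 + o + 2 ≡ m
    shape = trans (cong (2 +_) (+-comm (t * 4 + o) 2)) 4+4t+o≡m

  -- Here the pieces used above would need m + 1 positions, so the first five
  -- positions must carry weight 2 instead of 1 (or contain a free slot).
  free-slot-or-swapped-if-4s≡m+1 : ∀ m s → 6 ≤ m → s * 4 ≡ suc m → count 0 m ≤ s →
    VanishesFrom m → FreeSlot m ⊎ FreeSwappedSlot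
  free-slot-or-swapped-if-4s≡m+1 _ zero _ () _ _
  free-slot-or-swapped-if-4s≡m+1 _ 1 (s≤s (s≤s (s≤s ()))) refl _ _
  free-slot-or-swapped-if-4s≡m+1 _ (suc (suc u)) _ refl total tail with five-prefix
  ... | inj₁ z               = inj₁ (free-slot-at-start z)
  ... | inj₂ (inj₁ z)        = inj₁ (free-slot-inside 1 z (s≤s (s≤s (s≤s z≤n))))
  ... | inj₂ (inj₂ (inj₁ w)) = inj₂ w
  ... | inj₂ (inj₂ (inj₂ two)) = inj₁ (free-slot-after-prefix 5 u 0 2 shape two total tail)
    where
    shape : 5 + u * 4 + 0 + 2 ≡ 7 + u * 4
    shape = cong (5 +_) (trans (cong (_+ 2) (+-identityʳ (u * 4))) (+-comm (u * 4) 2))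

  free-slot-or-swapped : ∀ m s → 6 ≤ m → s * 4 ≤ suc m → count 0 m ≤ s →
    VanishesFrom m → FreeSlot m ⊎ FreeSwappedSlot
  free-slot-or-swapped m s 6≤m s*4≤1+m total tail with m≤n⇒m<n∨m≡n s*4≤1+m
  ... | inj₁ (s≤s s*4≤m) = inj₁ (free-slot-if-4s≤m m s (≤-trans (m≤m+n 2 4) 6≤m) s*4≤m total tail)
  ... | inj₂ s*4≡1+m     = free-slot-or-swapped-if-4s≡m+1 m s 6≤m s*4≡1+m total tail

-- y is the position of the old vertex x once a new vertex is inserted at position k.
Shift : ℕ → ℕ → ℕ → Set
Shift k x y = (x < k × y ≡ x) ⊎ (k ≤ x × y ≡ suc x)

toℕ-punchIn : ∀ {n} (i : Fin (suc n)) (j : Fin n) → Shift (toℕ i) (toℕ j) (toℕ (punchIn i j))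
toℕ-punchIn zero    j    = inj₂ (z≤n , refl)
toℕ-punchIn (suc i) zero = inj₁ (s≤s z≤n , refl)
toℕ-punchIn (suc i) (suc j) with toℕ-punchIn i j
... | inj₁ (j<i , eq) = inj₁ (s≤s j<i , cong suc eq)
... | inj₂ (i≤j , eq) = inj₂ (s≤s i≤j , cong suc eq)

PathSqStep : ℕ → ℕ → Set
PathSqStep x y = x < y × y ≤ x + 2

-- The steps of the square of the longer path between old vertices, in old
-- positions: k-1 and k+1 are no longer adjacent, the new vertex sits between them.
PunchedStep : ℕ → ℕ → ℕ → Set
PunchedStep k x y = PathSqStep x y × (x < k → k ≤ y → y ≤ x + 1)

shift-step-to-slot : ∀ {k y py} → Shift k y py → PathSqStep k py ⊎ PathSqStep py k →
  k ≤ y + 2 × y < k + 2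
shift-step-to-slot (inj₁ (y<k , refl)) (inj₁ (k<y , _)) = ⊥-elim (<-asym y<k k<y)
shift-step-to-slot {k} {y} (inj₁ (y<k , refl)) (inj₂ (_ , k≤y+2)) = k≤y+2 , ≤-trans y<k (m≤m+n k 2)
shift-step-to-slot {k} {y} (inj₂ (k≤y , refl)) (inj₁ (_ , y<k+2)) = ≤-trans k≤y (m≤m+n y 2) , y<k+2
shift-step-to-slot {k} {y} (inj₂ (k≤y , refl)) (inj₂ (y<k , _)) = ⊥-elim (<⇒≱ (<-trans (n<1+n y) y<k) k≤y)

shift-step : ∀ {k x y px py} → Shift k x px → Shift k y py → PathSqStep px py → PunchedStep k x y
shift-step (inj₁ (x<k , refl)) (inj₁ (y<k , refl)) step = step , λ _ k≤y → ⊥-elim (<⇒≱ y<k k≤y)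
shift-step {x = x} {y} (inj₁ (x<k , refl)) (inj₂ (k≤y , refl)) (_ , y<x+2) =
  (<-≤-trans x<k k≤y , ≤-trans (n≤1+n y) y<x+2) , λ _ _ → y≤x+1
  where
  y≤x+1 : y ≤ x + 1
  y≤x+1 = subst (y ≤_) (≡-sym (+-comm x 1)) (≤-pred (subst (suc y ≤_) (+-comm x 2) y<x+2))
shift-step (inj₂ (k≤x , refl)) (inj₁ (y<k , refl)) (x<y , _) =
  ⊥-elim (<⇒≱ (<-trans (n<1+n _) x<y) (≤-trans (<⇒≤ y<k) k≤x))
shift-step (inj₂ (k≤x , refl)) (inj₂ (k≤y , refl)) (s≤s x<y , s≤s y≤x+2) =
  (x<y , y≤x+2) , λ x<k _ → ⊥-elim (<⇒≱ x<k k≤x)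

insertion-view : ∀ {n} (i u : Fin (suc n)) → u ≡ i ⊎ ∃ λ a → u ≡ punchIn i a
insertion-view i u with i ≟ᶠ u
... | yes refl = inj₁ refl
... | no i≢u   = inj₂ (punchOut i≢u , ≡-sym (punchIn-punchOut i≢u))

insert-self : ∀ {m} (i j : Fin (suc m)) (π : Permutation′ m) → insert i j π ⟨$⟩ʳ i ≡ j
insert-self i j π with i ≟ᶠ i
... | yes _  = refl
... | no i≢i = ⊥-elim (i≢i refl)

indicator : Bool → ℕ
indicator true  = 1
indicator false = 0

∣∣-as-sum : ∀ {n} (S : Subset n) → sum (indicator ∘ lookup S) ≡ ∣ S ∣
∣∣-as-sum []          = refl
∣∣-as-sum (true ∷ S)  = cong suc (∣∣-as-sum S)
∣∣-as-sum (false ∷ S) = ∣∣-as-sum S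

zeroPad : ∀ {n} → (Fin n → ℕ) → ℕ → ℕ
zeroPad {zero}  f _       = 0
zeroPad {suc n} f zero    = f zero
zeroPad {suc n} f (suc j) = zeroPad (f ∘ suc) j

zeroPad-toℕ : ∀ {n} (f : Fin n → ℕ) w → zeroPad f (toℕ w) ≡ f w
zeroPad-toℕ f zero    = refl
zeroPad-toℕ f (suc w) = zeroPad-toℕ (f ∘ suc) w

zeroPad-≥ : ∀ {n} (f : Fin n → ℕ) j → n ≤ j → zeroPad f j ≡ 0
zeroPad-≥ {zero}  f j       _         = refl
zeroPad-≥ {suc n} f (suc j) (s≤s n≤j) = zeroPad-≥ (f ∘ suc) j n≤j

count-zeroPad-suc : ∀ {n} (f : Fin (suc n) → ℕ) a l →
  Windows.count (zeroPad f) (suc a) l ≡ Windows.count (zeroPad (f ∘ suc)) a l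
count-zeroPad-suc f a zero    = refl
count-zeroPad-suc f a (suc l) = cong (zeroPad f (suc a) +_) (count-zeroPad-suc f (suc a) l)

count-zeroPad : ∀ {n} (f : Fin n → ℕ) → Windows.count (zeroPad f) 0 n ≡ sum f
count-zeroPad {zero}  f = refl
count-zeroPad {suc n} f = cong (f zero +_) (trans (count-zeroPad-suc f 0 n) (count-zeroPad (f ∘ suc)))

module Insertion {m} (F : Graph m) (S : Subset m) (packing : Packs (PathSq m) F) where

  σ : Permutation′ m
  σ = proj₁ packing

  -- The old vertices keep their images under σ ∘ τ, the new vertex of F goes to
  -- position K of the longer path.
  packs-by-insertion : (K : Fin (suc m)) (τ : Permutation′ m) →
    (∀ a b → PunchedStep (toℕ K) (toℕ a) (toℕ b) → PathSqAdj (τ ⟨$⟩ʳ a) (τ ⟨$⟩ʳ b)) →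
    (∀ w → toℕ K ≤ toℕ w + 2 → toℕ w < toℕ K + 2 → ¬ (σ ⟨$⟩ʳ (τ ⟨$⟩ʳ w)) ∈ S) →
    Packs (PathSq (suc m)) (extend F S)
  packs-by-insertion K τ steps avoids = σ′ , respects
    where
    ρ : Permutation′ m
    ρ = τ ∘ₚ σ
    σ′ : Permutation′ (suc m)
    σ′ = insert K zero ρ
    shift : ∀ a → Shift (toℕ K) (toℕ a) (toℕ (punchIn K a))
    shift = toℕ-punchIn K
    old-edge : ∀ a b → PathSqAdj (punchIn K a) (punchIn K b) → PathSqAdj (τ ⟨$⟩ʳ a) (τ ⟨$⟩ʳ b)
    old-edge a b (inj₁ st) = steps a b (shift-step (shift a) (shift b) st)
    old-edge a b (inj₂ st) = swap (steps b a (shift-step (shift b) (shift a) st))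
    respects : ∀ u v → PathSqAdj u v → ¬ ExtAdj F S (σ′ ⟨$⟩ʳ u) (σ′ ⟨$⟩ʳ v)
    respects u v adj with insertion-view K u | insertion-view K v
    ... | inj₁ refl       | inj₁ refl = ⊥-elim (irrefl (PathSq (suc m)) K adj)
    ... | inj₁ refl       | inj₂ (b , refl) rewrite insert-self K zero ρ | insert-punchIn K zero ρ b =
      uncurry (avoids b) (shift-step-to-slot (shift b) adj)
    ... | inj₂ (a , refl) | inj₁ refl rewrite insert-self K zero ρ | insert-punchIn K zero ρ a =
      uncurry (avoids a) (shift-step-to-slot (shift a) (swap adj))
    ... | inj₂ (a , refl) | inj₂ (b , refl) rewrite insert-punchIn K zero ρ a | insert-punchIn K zero ρ b =
      proj₂ packing _ _ (old-edge a b adj)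

  weight : Fin m → ℕ
  weight w = indicator (lookup S (σ ⟨$⟩ʳ w))

  B : ℕ → ℕ
  B = zeroPad weight

  open Windows B public

  B≡0⇒∉ : ∀ w → B (toℕ w) ≡ 0 → ¬ (σ ⟨$⟩ʳ w) ∈ S
  B≡0⇒∉ w B≡0 w∈S =
    1+n≢0 (trans (cong indicator (≡-sym ([]=⇒lookup w∈S))) (trans (≡-sym (zeroPad-toℕ weight w)) B≡0))

  count-B : count 0 m ≡ ∣ S ∣
  count-B = begin
    count 0 m                        ≡⟨ count-zeroPad weight ⟩
    sum weight                       ≡⟨ ≡-sym (sum-permute (indicator ∘ lookup S) σ) ⟩
    sum (indicator ∘ lookup S)       ≡⟨ ∣∣-as-sum S ⟩
    ∣ S ∣                            ∎
    where open ≡-Reasoning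

  free-slot-packs : FreeSlot m → Packs (PathSq (suc m)) (extend F S)
  free-slot-packs (k , k≤m , free) =
    packs-by-insertion K idₚ (λ _ _ → inj₁ ∘ proj₁) avoids
    where
    K : Fin (suc m)
    K = fromℕ< (s≤s k≤m)
    avoids : ∀ w → toℕ K ≤ toℕ w + 2 → toℕ w < toℕ K + 2 → ¬ (σ ⟨$⟩ʳ w) ∈ S
    avoids w rewrite toℕ-fromℕ< (s≤s k≤m) = λ lo hi → B≡0⇒∉ w (free (toℕ w) lo hi)

swapped-slot-packs : ∀ {m} (F : Graph m) (S : Subset m) (packing : Packs (PathSq m) F) → 3 ≤ m →
  Insertion.FreeSwappedSlot F S packing → Packs (PathSq (suc m)) (extend F S)
swapped-slot-packs {suc (suc (suc n))} F S packing (s≤s (s≤s (s≤s _))) (B0 , B2 , B3 , B4) =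
  packs-by-insertion (suc (suc (suc zero))) swap₀₁ swap₀₁-steps avoids
  where
  open Insertion F S packing
  swap₀₁ : Permutation′ (3 + n)
  swap₀₁ = transpose zero (suc zero)
  swap₀₁-steps : ∀ a b → PunchedStep 3 (toℕ a) (toℕ b) → PathSqAdj (swap₀₁ ⟨$⟩ʳ a) (swap₀₁ ⟨$⟩ʳ b)
  swap₀₁-steps zero             (suc zero)             _ = inj₂ (s≤s z≤n , s≤s z≤n)
  swap₀₁-steps zero             (suc (suc zero))       _ = inj₁ (s≤s (s≤s z≤n) , s≤s (s≤s z≤n))
  swap₀₁-steps (suc zero)       (suc (suc zero))       _ = inj₁ (s≤s z≤n , s≤s (s≤s z≤n))
  swap₀₁-steps (suc (suc a))    (suc (suc b))          (step , _) = inj₁ step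
  swap₀₁-steps zero             zero                   ((() , _) , _)
  swap₀₁-steps zero             (suc (suc (suc _)))    ((_ , s≤s (s≤s ())) , _)
  swap₀₁-steps (suc zero)       zero                   ((() , _) , _)
  swap₀₁-steps (suc zero)       (suc zero)             ((s≤s () , _) , _)
  swap₀₁-steps (suc zero)       (suc (suc (suc zero))) (_ , straddle) with straddle (s≤s (s≤s z≤n)) ≤-refl
  ... | s≤s (s≤s ())
  swap₀₁-steps (suc zero)       (suc (suc (suc (suc _)))) ((_ , s≤s (s≤s (s≤s ()))) , _)
  swap₀₁-steps (suc (suc _))    zero                   ((() , _) , _)
  swap₀₁-steps (suc (suc _))    (suc zero)             ((s≤s () , _) , _)
  avoids : ∀ w → 3 ≤ toℕ w + 2 → toℕ w < 3 + 2 → ¬ (σ ⟨$⟩ʳ (swap₀₁ ⟨$⟩ʳ w)) ∈ S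
  avoids zero                            (s≤s (s≤s ())) _
  avoids (suc zero)                      _ _ = B≡0⇒∉ zero B0
  avoids (suc (suc zero))                _ _ = B≡0⇒∉ (suc (suc zero)) B2
  avoids (suc (suc (suc zero)))          _ _ = B≡0⇒∉ (suc (suc (suc zero))) B3
  avoids (suc (suc (suc (suc zero))))    _ _ = B≡0⇒∉ (suc (suc (suc (suc zero)))) B4
  avoids (suc (suc (suc (suc (suc _))))) _ (s≤s (s≤s (s≤s (s≤s (s≤s ())))))

proposition2p1 : (m : ℕ) → 7 ≤ suc m → (s : ℕ) → s ≤ suc m / 4 →
    (F : Graph m) → Packs (PathSq m) F →
    (S : Subset m) → ∣ S ∣ ≡ s →
    Packs (PathSq (suc m)) (extend F S)
proposition2p1 m (s≤s 6≤m) s s≤⌊1+m/4⌋ F packing S refl =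
  [ free-slot-packs , swapped-slot-packs F S packing (≤-trans (m≤m+n 3 3) 6≤m) ]′
    (free-slot-or-swapped m s 6≤m s*4≤1+m (≤-reflexive count-B) (zeroPad-≥ weight))
  where
  open Insertion F S packing
  s*4≤1+m : s * 4 ≤ suc m
  s*4≤1+m = ≤-trans (*-monoˡ-≤ 4 s≤⌊1+m/4⌋) (m/n*n≤m (suc m) 4)
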